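{- Let $\lambda\vdash n$ with $\lambda'=(s,r)$, $s\ge r\ge1$, let $\pi$ be a minimal permutation of shape $\lambda$, and let $0\le \Delta<r$. Then the number of jump partitions $J=(\mu,\nu)$ for $\pi$ of size $|\mu|+|\nu|=\Delta$ equals $p_2(\Delta)$.
   Context: A minimal permutation of shape $\lambda$ (Robinson–Schensted shape; $\lambda'$ the conjugate partition) is one with the fewest inversions among permutations of that shape; for $\lambda'=(s,r)$ these are exactly $(c_1,c_1-1,\dots,1,\,n,\dots,c_1+1)$ with $(c_1,c_2)\in\{(s,r),(r,s)\}$, $n=s+r$. For such $\pi$, a jump partition is a pair $J=(\mu,\nu)$ of integer partitions (each possibly empty) with $\ell(\mu)\le c_1$, $\mu_1<c_2$, $\ell(\nu)\le c_1$, $\nu_1<c_2$; its size is $|\mu|+|\nu|$. $p_2(m)$ is the number of partitions of $m$ into parts of two colours, i.e. $\sum_{m\ge0}p_2(m)x^m=\prod_{k\ge1}(1-x^k)^{ -2}$. -}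

module Defs where

open import Data.Nat using (ℕ; zero; suc; _+_; _*_; _∸_; _≤_; _<_)
open import Data.Nat.Divisibility using (_∣?_)
open import Data.Nat.ListAction using (sum)
open import Data.List using (List; []; _∷_; _++_; map; length; downFrom; upTo; foldr)
open import Data.List.Relation.Unary.All using (All)
open import Data.List.Relation.Unary.Linked using (Linked)
open import Data.Product using (Σ; _×_; ∃; ∃-syntax; _,_)
open import Data.Sum using (_⊎_)
open import Data.Bool using (if_then_else_)
open import Relation.Nullary using (does)
open import Relation.Binary.PropositionalEquality using (_≡_)
open import Data.Nat using (_≥_)

IsPartition : List ℕ → Set
IsPartition l = Linked _≥_ l × All (λ x → 0 < x) l

Partition : Set
Partition = Σ (List ℕ) IsPartition

size : Partition → ℕ
size (l , _) = sum l

len : Partition → ℕ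
len (l , _) = length l

largest : Partition → ℕ
largest ([] , _) = 0
largest ((x ∷ _) , _) = x

-- Minimal permutations for λ' = (s , r), in one-line notation
-- minPerm c₁ c₂ = (c₁, c₁-1, …, 1, n, …, c₁+1), n = c₁ + c₂

minPerm : ℕ → ℕ → List ℕ
minPerm c₁ c₂ = map suc (downFrom c₁) ++ map (λ i → c₁ + suc i) (downFrom c₂)

-- π is a minimal permutation of shape λ with λ' = (s , r)
-- (using the characterisation given in the paper)
IsMinimal : ℕ → ℕ → List ℕ → Set
IsMinimal s r π =
  ∃[ c₁ ] ∃[ c₂ ] (((c₁ ≡ s × c₂ ≡ r) ⊎ (c₁ ≡ r × c₂ ≡ s)) × π ≡ minPerm c₁ c₂)

firstEntry : List ℕ → ℕ
firstEntry [] = 0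
firstEntry (x ∷ _) = x

c₁of : List ℕ → ℕ
c₁of π = firstEntry π

c₂of : List ℕ → ℕ
c₂of π = length π ∸ firstEntry π

IsJump : List ℕ → Partition → Partition → Set
IsJump π μ ν =
  len μ ≤ c₁of π × largest μ < c₂of π × len ν ≤ c₁of π × largest ν < c₂of π

JumpOfSize : List ℕ → ℕ → Set
JumpOfSize π Δ = Σ Partition λ μ → Σ Partition λ ν → IsJump π μ ν × size μ + size ν ≡ Δ

-- p₂ via its generating function ∏_{k≥1} (1 - x^k)^{-2}.
-- Power series are coefficient functions ℕ → ℕ.

Series : Set
Series = ℕ → ℕ

one : Series
one zero = 1
one (suc _) = 0

_⊛_ : Series → Series → Series
(f ⊛ g) i = sum (map (λ j → f j * g (i ∸ j)) (upTo (suc i)))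

-- 1/(1 - x^(k+1)) = Σ_{t≥0} x^{t(k+1)}
geomS : ℕ → Series
geomS k i = if does (suc k ∣? i) then 1 else 0

-- ∏_{k=1}^{N} (1 - x^k)^{-2}
prodS : ℕ → Series
prodS zero = one
prodS (suc N) = (geomS N ⊛ geomS N) ⊛ prodS N

-- coefficient of x^m; factors with k > m do not affect it
p₂ : ℕ → ℕ
p₂ m = prodS m m

-- The coefficient p₂(Δ) of ∏_{k ≤ Δ} (1 - x^k)^{-2} counts pairs of partitions of total size Δ with
-- all parts ≤ Δ: the factor (1 - x^k)^{-2} chooses how many parts equal to k go into each of the
-- two partitions. For the minimal permutation both c₁ and c₂ are at least r > Δ, so a pair of total
-- size Δ automatically has length ≤ Δ ≤ c₁ and largest part ≤ Δ < c₂; the jump conditions are vacuous.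
module Submission where

open import Defs
open import Data.Nat using (ℕ; _≤_; _<_)
open import Data.List using (List)
open import Data.Fin using (Fin)
open import Function.Bundles using (_↔_)

open import Data.Bool using (if_then_else_)
open import Data.Empty using (⊥-elim)
open import Data.Fin.Properties using (+↔⊎; *↔×)
open import Data.List using ([]; _∷_; _++_; map; length; replicate; applyUpTo; downFrom)
open import Data.List.Properties using (map-applyUpTo; length-++; length-map; length-downFrom)
open import Data.List.Relation.Unary.All as All using (All; []; _∷_)
open import Data.List.Relation.Unary.Linked as Linked using (Linked; []; [-]; _∷_)
open import Data.List.Relation.Unary.Linked.Properties using (Linked⇒All)
open import Data.Nat using (zero; suc; _+_; _*_; _∸_; _≥_; _≟_; z≤n; s≤s)
open import Data.Nat.Divisibility using (_∣_; _∣?_; divides)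
open import Data.Nat.ListAction using (sum)
open import Data.Nat.ListAction.Properties using (sum-++)
open import Data.Nat.Properties
open import Algebra.Properties.CommutativeSemigroup +-commutativeSemigroup using (interchange)
open import Data.Product using (Σ; _×_; _,_; proj₁; proj₂; map₁)
open import Data.Product.Function.Dependent.Propositional using (Σ-↔)
open import Data.Product.Function.NonDependent.Propositional using (_×-↔_)
open import Data.Product.Properties using (Σ-≡,≡→≡)
open import Data.Sum using (_⊎_; inj₁; inj₂)
open import Data.Sum.Function.Propositional using (_⊎-↔_)
open import Data.Unit using (⊤; tt)
open import Function.Bundles using (Inverse; mk↔ₛ′)
open import Function.Properties.Inverse using (↔-refl; ↔-sym; ↔-trans)
open import Relation.Binary.PropositionalEquality
open import Relation.Nullary using (Dec; yes; no; does)
open import Relation.Unary using (Irrelevant)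

OfWeight : {X : Set} → (X → ℕ) → ℕ → Set
OfWeight {X} w i = Σ X λ x → w x ≡ i

Enumerates : Series → {X : Set} → (X → ℕ) → Set
Enumerates f w = ∀ i → Fin (f i) ↔ OfWeight w i

_⊕_ : {X Y : Set} → (X → ℕ) → (Y → ℕ) → X × Y → ℕ
(w ⊕ v) p = w (proj₁ p) + v (proj₂ p)

≡ˡ-↔ : {a b c : ℕ} → a ≡ b → (a ≡ c) ↔ (b ≡ c)
≡ˡ-↔ refl = ↔-refl

Enumerates-transport : {X Y : Set} {f : Series} {w : X → ℕ} {v : Y → ℕ} (φ : X ↔ Y) →
                       (∀ x → w x ≡ v (Inverse.to φ x)) → Enumerates f w → Enumerates f v
Enumerates-transport φ w≡v ef i = ↔-trans (ef i) (Σ-↔ φ (λ {x} → ≡ˡ-↔ (w≡v x)))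

one-enumerates : Enumerates one (λ (_ : ⊤) → 0)
one-enumerates zero = mk↔ₛ′ (λ _ → tt , refl) (λ _ → Fin.zero)
  (λ { (tt , refl) → refl }) (λ { Fin.zero → refl ; (Fin.suc ()) })
one-enumerates (suc i) = mk↔ₛ′ (λ ()) (λ { (_ , ()) }) (λ { (_ , ()) }) (λ ())

Fin-sum-applyUpTo↔ : (h : ℕ → ℕ) (n : ℕ) →
                     Fin (sum (applyUpTo h n)) ↔ Σ ℕ (λ j → j < n × Fin (h j))
Fin-sum-applyUpTo↔ h zero = mk↔ₛ′ (λ ()) (λ { (_ , () , _) }) (λ { (_ , () , _) }) (λ ())
Fin-sum-applyUpTo↔ h (suc n) =
  ↔-trans +↔⊎ (↔-trans (↔-refl ⊎-↔ Fin-sum-applyUpTo↔ (λ j → h (suc j)) n) split-zero)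
  where
  split-zero : (Fin (h 0) ⊎ Σ ℕ (λ j → j < n × Fin (h (suc j)))) ↔
               Σ ℕ (λ j → j < suc n × Fin (h j))
  split-zero = mk↔ₛ′
    (λ { (inj₁ x) → 0 , s≤s z≤n , x ; (inj₂ (j , j<n , x)) → suc j , s≤s j<n , x })
    (λ { (zero , _ , x) → inj₁ x ; (suc j , s≤s j<n , x) → inj₂ (j , j<n , x) })
    (λ { (zero , s≤s z≤n , x) → refl ; (suc j , s≤s j<n , x) → refl })
    (λ { (inj₁ x) → refl ; (inj₂ _) → refl })

antidiagonal↔OfWeight : {X Y : Set} (w : X → ℕ) (v : Y → ℕ) (i : ℕ) →
  Σ ℕ (λ j → j < suc i × (OfWeight w j × OfWeight v (i ∸ j))) ↔ OfWeight (w ⊕ v) i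
antidiagonal↔OfWeight w v i = mk↔ₛ′ to from to∘from from∘to
  where
  to : Σ ℕ (λ j → j < suc i × (OfWeight w j × OfWeight v (i ∸ j))) → OfWeight (w ⊕ v) i
  to (_ , s≤s wx≤i , (x , refl) , (y , e)) = (x , y) , trans (cong (w x +_) e) (m+[n∸m]≡n wx≤i)
  from : OfWeight (w ⊕ v) i → Σ ℕ (λ j → j < suc i × (OfWeight w j × OfWeight v (i ∸ j)))
  from ((x , y) , e) = w x , s≤s (subst (w x ≤_) e (m≤m+n (w x) (v y))) , (x , refl) ,
                       (y , sym (subst (λ k → k ∸ w x ≡ v y) e (m+n∸m≡n (w x) (v y))))
  to∘from : ∀ p → to (from p) ≡ p
  to∘from ((x , y) , _) = cong ((x , y) ,_) (≡-irrelevant _ _)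
  from∘to : ∀ q → from (to q) ≡ q
  from∘to (_ , s≤s _ , (x , refl) , (y , _)) =
    cong₂ (λ p e → w x , p , (x , refl) , (y , e)) (≤-irrelevant _ _) (≡-irrelevant _ _)

⊛-enumerates : {X Y : Set} {f g : Series} {w : X → ℕ} {v : Y → ℕ} →
               Enumerates f w → Enumerates g v → Enumerates (f ⊛ g) (w ⊕ v)
⊛-enumerates {f = f} {g} {w} {v} ef eg i =
  ↔-trans (≡⇒Fin↔ (cong sum (map-applyUpTo (λ j → j) term (suc i))))
  (↔-trans (Fin-sum-applyUpTo↔ term (suc i))
  (↔-trans (Σ-↔ ↔-refl (λ {j} → ↔-refl ×-↔ ↔-trans *↔× (ef j ×-↔ eg (i ∸ j))))
  (antidiagonal↔OfWeight w v i)))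
  where
  term : ℕ → ℕ
  term j = f j * g (i ∸ j)
  ≡⇒Fin↔ : {m n : ℕ} → m ≡ n → Fin m ↔ Fin n
  ≡⇒Fin↔ refl = ↔-refl

geomS-enumerates : ∀ N → Enumerates (geomS N) (λ t → t * suc N)
geomS-enumerates N i = by-divisibility (suc N ∣? i)
  where
  multiple-unique : (p q : OfWeight (λ t → t * suc N) i) → p ≡ q
  multiple-unique (t , e) (t′ , e′) with *-cancelʳ-≡ t t′ (suc N) (trans e (sym e′))
  ... | refl = cong (t ,_) (≡-irrelevant e e′)
  by-divisibility : (d : Dec (suc N ∣ i)) →
                    Fin (if does d then 1 else 0) ↔ OfWeight (λ t → t * suc N) i
  by-divisibility (yes (divides q i≡q*k)) = mk↔ₛ′ (λ _ → q , sym i≡q*k) (λ _ → Fin.zero)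
    (multiple-unique _) (λ { Fin.zero → refl ; (Fin.suc ()) })
  by-divisibility (no k∤i) = mk↔ₛ′ (λ ()) (λ { (t , e) → ⊥-elim (k∤i (divides t (sym e))) })
    (λ { (t , e) → ⊥-elim (k∤i (divides t (sym e))) }) (λ ())

BoundedPartition : ℕ → Set
BoundedPartition N = Σ Partition λ μ → All (_≤ N) (proj₁ μ)

parts : ∀ {N} → BoundedPartition N → List ℕ
parts μ = proj₁ (proj₁ μ)

weight : ∀ {N} → BoundedPartition N → ℕ
weight μ = size (proj₁ μ)

IsPartition-irrelevant : Irrelevant IsPartition
IsPartition-irrelevant (L , pos) (L′ , pos′) =
  cong₂ _,_ (Linked.irrelevant ≤-irrelevant L L′) (All.irrelevant <-irrelevant pos pos′)

BoundedPartition-≡ : ∀ {N} {μ ν : BoundedPartition N} → parts μ ≡ parts ν → μ ≡ ν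
BoundedPartition-≡ eq =
  Σ-≡,≡→≡ (Σ-≡,≡→≡ (eq , IsPartition-irrelevant _ _) , All.irrelevant ≤-irrelevant _ _)

∅ : ∀ {N} → BoundedPartition N
∅ = ([] , [] , []) , []

BoundedPartition-zero-empty : (μ : BoundedPartition 0) → parts μ ≡ []
BoundedPartition-zero-empty (([] , _) , _) = refl
BoundedPartition-zero-empty (((_ ∷ _) , _ , 0<x ∷ _) , x≤0 ∷ _) = ⊥-elim (<⇒≱ 0<x x≤0)

⊤↔BoundedPartition-zero² : ⊤ ↔ (BoundedPartition 0 × BoundedPartition 0)
⊤↔BoundedPartition-zero² = mk↔ₛ′ (λ _ → ∅ , ∅) (λ _ → tt)
  (λ { (μ , ν) → cong₂ _,_ (BoundedPartition-≡ (sym (BoundedPartition-zero-empty μ)))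
                           (BoundedPartition-≡ (sym (BoundedPartition-zero-empty ν))) })
  (λ { tt → refl })

splitLeading : ℕ → List ℕ → ℕ × List ℕ
splitLeading k [] = 0 , []
splitLeading k (x ∷ xs) with x ≟ k
... | yes _ = map₁ suc (splitLeading k xs)
... | no _ = 0 , x ∷ xs

replicate++splitLeading : ∀ k l →
                          replicate (proj₁ (splitLeading k l)) k ++ proj₂ (splitLeading k l) ≡ l
replicate++splitLeading k [] = refl
replicate++splitLeading k (x ∷ xs) with x ≟ k
... | yes refl = cong (x ∷_) (replicate++splitLeading k xs)
... | no _ = refl

splitLeading-replicate++ : ∀ {N} t {μ} → All (_≤ N) μ →
                           splitLeading (suc N) (replicate t (suc N) ++ μ) ≡ (t , μ)
splitLeading-replicate++ {N} zero {[]} _ = refl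
splitLeading-replicate++ {N} zero {x ∷ _} (x≤N ∷ _) with x ≟ suc N
... | yes refl = ⊥-elim (<⇒≱ (n<1+n N) x≤N)
... | no _ = refl
splitLeading-replicate++ {N} (suc t) μ≤N with suc N ≟ suc N
... | yes _ = cong (map₁ suc) (splitLeading-replicate++ t μ≤N)
... | no k≢k = ⊥-elim (k≢k refl)

splitLeading-IsPartition : ∀ k {l} → IsPartition l → IsPartition (proj₂ (splitLeading k l))
splitLeading-IsPartition k {[]} p = p
splitLeading-IsPartition k {x ∷ xs} p@(L , _ ∷ pos) with x ≟ k
... | yes _ = splitLeading-IsPartition k (Linked.tail L , pos)
... | no _ = p

splitLeading-bounded : ∀ {N l} → IsPartition l → All (_≤ suc N) l →
                       All (_≤ N) (proj₂ (splitLeading (suc N) l))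
splitLeading-bounded {N} {[]} _ _ = []
splitLeading-bounded {N} {x ∷ xs} (L , _ ∷ pos) (x≤k ∷ xs≤k) with x ≟ suc N
... | yes _ = splitLeading-bounded (Linked.tail L , pos) xs≤k
... | no x≢k = Linked⇒All (λ j≤i k≤j → ≤-trans k≤j j≤i) (≤-pred (≤∧≢⇒< x≤k x≢k)) L

Linked-≥-∷ : ∀ {x xs} → All (_≤ x) xs → Linked _≥_ xs → Linked _≥_ (x ∷ xs)
Linked-≥-∷ [] _ = [-]
Linked-≥-∷ (y≤x ∷ _) L = y≤x ∷ L

replicate++-bounded : ∀ {N} t {μ} → All (_≤ N) μ → All (_≤ suc N) (replicate t (suc N) ++ μ)
replicate++-bounded zero μ≤N = All.map m≤n⇒m≤1+n μ≤N
replicate++-bounded (suc t) μ≤N = ≤-refl ∷ replicate++-bounded t μ≤N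

replicate++-IsPartition : ∀ {N} t {μ} → All (_≤ N) μ → IsPartition μ →
                          IsPartition (replicate t (suc N) ++ μ)
replicate++-IsPartition zero _ p = p
replicate++-IsPartition (suc t) μ≤N p with replicate++-IsPartition t μ≤N p
... | L , pos = Linked-≥-∷ (replicate++-bounded t μ≤N) L , s≤s z≤n ∷ pos

sum-replicate++ : ∀ t k μ → sum (replicate t k ++ μ) ≡ t * k + sum μ
sum-replicate++ t k μ = trans (sum-++ (replicate t k) μ) (cong (_+ sum μ) (sum-replicate t))
  where
  sum-replicate : ∀ t → sum (replicate t k) ≡ t * k
  sum-replicate zero = refl
  sum-replicate (suc t) = cong (k +_) (sum-replicate t)

addLargestParts : ∀ {N} → ℕ × BoundedPartition N → BoundedPartition (suc N)
addLargestParts {N} (t , ((μ , p) , μ≤N)) =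
  (replicate t (suc N) ++ μ , replicate++-IsPartition t μ≤N p) , replicate++-bounded t μ≤N

removeLargestParts : ∀ {N} → BoundedPartition (suc N) → ℕ × BoundedPartition N
removeLargestParts {N} ((μ , p) , μ≤k) =
  proj₁ (splitLeading (suc N) μ) ,
  ((proj₂ (splitLeading (suc N) μ) , splitLeading-IsPartition (suc N) p) ,
   splitLeading-bounded p μ≤k)

addLargestParts↔ : ∀ {N} → (ℕ × BoundedPartition N) ↔ BoundedPartition (suc N)
addLargestParts↔ {N} = mk↔ₛ′ addLargestParts removeLargestParts
  (λ μ → BoundedPartition-≡ (replicate++splitLeading (suc N) (parts μ)))
  (λ { (t , μ) → cong₂ _,_ (cong proj₁ (split t μ))
                           (BoundedPartition-≡ (cong proj₂ (split t μ))) })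
  where
  split : ∀ t (μ : BoundedPartition N) →
          splitLeading (suc N) (replicate t (suc N) ++ parts μ) ≡ (t , parts μ)
  split t μ = splitLeading-replicate++ t (proj₂ μ)

weight-addLargestParts : ∀ {N} t (μ : BoundedPartition N) →
                         weight (addLargestParts (t , μ)) ≡ t * suc N + weight μ
weight-addLargestParts {N} t μ = sum-replicate++ t (suc N) (parts μ)

pairWeight : ∀ {N} → BoundedPartition N × BoundedPartition N → ℕ
pairWeight = weight ⊕ weight

×-interchange↔ : {A B C D : Set} → ((A × B) × (C × D)) ↔ ((A × C) × (B × D))
×-interchange↔ = mk↔ₛ′ (λ { ((a , b) , (c , d)) → (a , c) , (b , d) })
                       (λ { ((a , c) , (b , d)) → (a , b) , (c , d) })
                       (λ _ → refl) (λ _ → refl)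

prodS-enumerates : ∀ N → Enumerates (prodS N) (pairWeight {N})
prodS-enumerates zero = Enumerates-transport ⊤↔BoundedPartition-zero² (λ _ → refl) one-enumerates
prodS-enumerates (suc N) =
  Enumerates-transport shuffle weights-agree
    (⊛-enumerates (⊛-enumerates (geomS-enumerates N) (geomS-enumerates N)) (prodS-enumerates N))
  where
  multiplesWeight : ℕ × ℕ → ℕ
  multiplesWeight = (λ t → t * suc N) ⊕ (λ t → t * suc N)
  shuffle : ((ℕ × ℕ) × (BoundedPartition N × BoundedPartition N)) ↔
            (BoundedPartition (suc N) × BoundedPartition (suc N))
  shuffle = ↔-trans ×-interchange↔ (addLargestParts↔ ×-↔ addLargestParts↔)
  weights-agree : ∀ p → (multiplesWeight ⊕ pairWeight) p ≡ pairWeight (Inverse.to shuffle p)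
  weights-agree ((t₁ , t₂) , (μ , ν)) = begin
    (t₁ * suc N + t₂ * suc N) + (weight μ + weight ν)
      ≡⟨ interchange (t₁ * suc N) (t₂ * suc N) (weight μ) (weight ν) ⟩
    (t₁ * suc N + weight μ) + (t₂ * suc N + weight ν)
      ≡⟨ sym (cong₂ _+_ (weight-addLargestParts t₁ μ) (weight-addLargestParts t₂ ν)) ⟩
    weight (addLargestParts (t₁ , μ)) + weight (addLargestParts (t₂ , ν)) ∎
    where open ≡-Reasoning

parts≤sum : ∀ l → All (_≤ sum l) l
parts≤sum [] = []
parts≤sum (x ∷ xs) =
  m≤m+n x (sum xs) ∷ All.map (λ y≤ → ≤-trans y≤ (m≤n+m (sum xs) x)) (parts≤sum xs)

length≤sum : ∀ {l} → All (0 <_) l → length l ≤ sum l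
length≤sum [] = z≤n
length≤sum (0<x ∷ pos) = +-mono-≤ 0<x (length≤sum pos)

largest≤ : ∀ {N} (μ : Partition) → All (_≤ N) (proj₁ μ) → largest μ ≤ N
largest≤ ([] , _) _ = z≤n
largest≤ ((_ ∷ _) , _) (x≤N ∷ _) = x≤N

JumpOfSize↔OfWeight : ∀ π Δ → Δ ≤ c₁of π → Δ < c₂of π →
                      JumpOfSize π Δ ↔ OfWeight (pairWeight {Δ}) Δ
JumpOfSize↔OfWeight π Δ Δ≤c₁ Δ<c₂ = mk↔ₛ′ to from to∘from from∘to
  where
  sizeˡ≤ : ∀ {a b} → a + b ≡ Δ → a ≤ Δ
  sizeˡ≤ {a} {b} e = subst (a ≤_) e (m≤m+n a b)
  sizeʳ≤ : ∀ {a b} → a + b ≡ Δ → b ≤ Δ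
  sizeʳ≤ {a} {b} e = subst (b ≤_) e (m≤n+m b a)
  bound : (μ : Partition) → size μ ≤ Δ → BoundedPartition Δ
  bound μ μ≤Δ = μ , All.map (λ x≤ → ≤-trans x≤ μ≤Δ) (parts≤sum (proj₁ μ))
  len≤c₁ : (μ : Partition) → size μ ≤ Δ → len μ ≤ c₁of π
  len≤c₁ μ μ≤Δ = ≤-trans (length≤sum (proj₂ (proj₂ μ))) (≤-trans μ≤Δ Δ≤c₁)
  largest<c₂ : (μ : BoundedPartition Δ) → largest (proj₁ μ) < c₂of π
  largest<c₂ (μ , μ≤Δ) = ≤-<-trans (largest≤ μ μ≤Δ) Δ<c₂
  to : JumpOfSize π Δ → OfWeight pairWeight Δ
  to (μ , ν , _ , e) = (bound μ (sizeˡ≤ e) , bound ν (sizeʳ≤ e)) , e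
  from : OfWeight pairWeight Δ → JumpOfSize π Δ
  from ((μ , ν) , e) =
    proj₁ μ , proj₁ ν ,
    (len≤c₁ (proj₁ μ) (sizeˡ≤ e) , largest<c₂ μ , len≤c₁ (proj₁ ν) (sizeʳ≤ e) , largest<c₂ ν) , e
  to∘from : ∀ p → to (from p) ≡ p
  to∘from (((μ , μ≤Δ) , (ν , ν≤Δ)) , e) = cong₂ (λ μ≤ ν≤ → ((μ , μ≤) , (ν , ν≤)) , e)
    (All.irrelevant ≤-irrelevant _ μ≤Δ) (All.irrelevant ≤-irrelevant _ ν≤Δ)
  from∘to : ∀ j → from (to j) ≡ j
  from∘to (μ , ν , (a , b , c , d) , e) =
    cong (λ j → μ , ν , j , e) (cong₂ _,_ (≤-irrelevant _ a) (cong₂ _,_ (≤-irrelevant _ b)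
      (cong₂ _,_ (≤-irrelevant _ c) (≤-irrelevant _ d))))

length-minPerm : ∀ c₁ c₂ → length (minPerm c₁ c₂) ≡ c₁ + c₂
length-minPerm c₁ c₂ = trans (length-++ (map suc (downFrom c₁)))
  (cong₂ _+_ (trans (length-map suc (downFrom c₁)) (length-downFrom c₁))
             (trans (length-map _ (downFrom c₂)) (length-downFrom c₂)))

c₁of-minPerm : ∀ {c₁} c₂ → 1 ≤ c₁ → c₁of (minPerm c₁ c₂) ≡ c₁
c₁of-minPerm {suc _} _ _ = refl

c₂of-minPerm : ∀ {c₁} c₂ → 1 ≤ c₁ → c₂of (minPerm c₁ c₂) ≡ c₂
c₂of-minPerm {c₁} c₂ 1≤c₁ = begin
  length (minPerm c₁ c₂) ∸ c₁of (minPerm c₁ c₂)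
    ≡⟨ cong₂ _∸_ (length-minPerm c₁ c₂) (c₁of-minPerm c₂ 1≤c₁) ⟩
  c₁ + c₂ ∸ c₁
    ≡⟨ m+n∸m≡n c₁ c₂ ⟩
  c₂ ∎
  where open ≡-Reasoning

columns≥ : ∀ {s r c₁ c₂} → r ≤ s → (c₁ ≡ s × c₂ ≡ r) ⊎ (c₁ ≡ r × c₂ ≡ s) → r ≤ c₁ × r ≤ c₂
columns≥ r≤s (inj₁ (refl , refl)) = r≤s , ≤-refl
columns≥ r≤s (inj₂ (refl , refl)) = ≤-refl , r≤s

proposition18 : (s r : ℕ) → r ≤ s → 1 ≤ r → (π : List ℕ) → IsMinimal s r π →
                (Δ : ℕ) → Δ < r → Fin (p₂ Δ) ↔ JumpOfSize π Δ
proposition18 s r r≤s 1≤r π (c₁ , c₂ , shape , refl) Δ Δ<r =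
  ↔-trans (prodS-enumerates Δ Δ) (↔-sym (JumpOfSize↔OfWeight π Δ Δ≤c₁ Δ<c₂))
  where
  r≤c₁ : r ≤ c₁
  r≤c₁ = proj₁ (columns≥ r≤s shape)
  r≤c₂ : r ≤ c₂
  r≤c₂ = proj₂ (columns≥ r≤s shape)
  1≤c₁ : 1 ≤ c₁
  1≤c₁ = ≤-trans 1≤r r≤c₁
  Δ≤c₁ : Δ ≤ c₁of π
  Δ≤c₁ = subst (Δ ≤_) (sym (c₁of-minPerm c₂ 1≤c₁)) (<⇒≤ (<-≤-trans Δ<r r≤c₁))
  Δ<c₂ : Δ < c₂of π
  Δ<c₂ = subst (Δ <_) (sym (c₂of-minPerm c₂ 1≤c₁)) (<-≤-trans Δ<r r≤c₂)
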